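{- For every nonnegative integer $i$ there exist a tree $G=(V,E,\ell)$ with nonnegative edge lengths and a set $R\subseteq V$ of $k=2^i$ terminals such that every distance-preserving minor $G'$ of $G$ with respect to $R$ has at least $2k-2$ vertices. In particular, $f^*(k,\mathrm{Trees})\ge 2k-2$ whenever $k$ is a power of $2$, where $\mathrm{Trees}$ is the family of all trees.
   Context: $d_H$ denotes shortest-path distance in a graph $H$ with respect to its edge lengths. Given a graph $G=(V,E,\ell)$ and terminals $R\subseteq V$, a distance-preserving minor of $G$ with respect to $R$ is a graph $G'$ with edge lengths $\ell'$ (which may differ from $\ell$) such that $G'$ is a minor of $G$ in which the terminals survive (terminals are never deleted and no two terminals are merged; a terminal may be merged with non-terminals by contraction and the resulting vertex is identified with that terminal), so $R\subseteq V(G')$, and $d_{G'}(u,v)=d_G(u,v)$ for all $u,v\in R$. For a family $\mathcal{F}$ of graphs, $f^*(k,\mathcal{F})$ is the minimum number such that every graph in $\mathcal{F}$, with any nonnegative edge lengths and any $k$ terminals, admits a distance-preserving minor with at most $f^*(k,\mathcal{F})$ vertices.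
   Formalization: The edge lengths $\ell'$ of every distance-preserving minor $G'$ are taken to be nonnegative rationals. -}

module Defs where

open import Data.Nat using (ℕ; suc)
open import Data.Fin using (Fin; zero; suc; inject₁; fromℕ)
open import Data.Rational using (ℚ; 0ℚ; _+_; _≤_)
open import Data.Product using (Σ; ∃; ∃-syntax; _×_; _,_)
open import Data.Sum using (_⊎_)
open import Data.Unit using (⊤)
open import Data.Maybe using (Maybe; just)
open import Data.List using (List)
open import Data.List.Membership.Propositional using (_∈_)
open import Data.List.Relation.Unary.All using (All)
open import Data.List.Relation.Unary.AllPairs using (AllPairs)
open import Relation.Binary.PropositionalEquality using (_≡_; _≢_)
open import Relation.Nullary using (¬_)
open import Function.Definitions using (Injective)

-- A finite graph with vertex set Fin size and a list of (undirected)
-- edges, each edge given as (endpoint, endpoint, length) with ℚ length.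
record WGraph : Set where
  constructor mkG
  field
    size  : ℕ
    edges : List (Fin size × Fin size × ℚ)
open WGraph public

module _ (G : WGraph) where

  Adj : Fin (size G) → Fin (size G) → ℚ → Set
  Adj u v l = ((u , v , l) ∈ edges G) ⊎ ((v , u , l) ∈ edges G)

  Adj₀ : Fin (size G) → Fin (size G) → Set
  Adj₀ u v = ∃[ l ] Adj u v l

  NonNeg : Set
  NonNeg = All (λ { (_ , _ , l) → 0ℚ ≤ l }) (edges G)

  data Walk : Fin (size G) → Fin (size G) → ℚ → Set where
    here : ∀ {u} → Walk u u 0ℚ
    step : ∀ {u w v l d} → Adj u w l → Walk w v d → Walk u v (l + d)

  IsDist : Fin (size G) → Fin (size G) → ℚ → Set
  IsDist u v d = Walk u v d × (∀ d' → Walk u v d' → d ≤ d')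

  data WalkIn (P : Fin (size G) → Set) : Fin (size G) → Fin (size G) → Set where
    nil  : ∀ {u} → P u → WalkIn P u u
    cons : ∀ {u w v} → P u → Adj₀ u w → WalkIn P w v → WalkIn P u v

  SameEnds : (Fin (size G) × Fin (size G) × ℚ) → (Fin (size G) × Fin (size G) × ℚ) → Set
  SameEnds (a , b , _) (c , d , _) = (a ≡ c × b ≡ d) ⊎ (a ≡ d × b ≡ c)

  Simple : Set
  Simple = (∀ u v l → (u , v , l) ∈ edges G → u ≢ v)
         × AllPairs (λ e f → ¬ SameEnds e f) (edges G)

  Connected : Set
  Connected = ∀ u v → WalkIn (λ _ → ⊤) u v

  -- a cycle: m+3 distinct vertices c₀,…,c_{m+2}, consecutive ones adjacent,
  -- and c_{m+2} adjacent to c₀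
  record Cycle : Set where
    field
      len    : ℕ
      c      : Fin (suc (suc (suc len))) → Fin (size G)
      inj    : Injective _≡_ _≡_ c
      consec : ∀ (i : Fin (suc (suc len))) → Adj₀ (c (inject₁ i)) (c (suc i))
      close  : Adj₀ (c (fromℕ (suc (suc len)))) (c zero)

  -- a tree: nonempty, simple, connected, acyclic
  IsTree : Set
  IsTree = Fin (size G) × Simple × Connected × ¬ Cycle

-- A model of the minor H in G, together with terminals τ : Fin k → V(G):
-- β assigns each vertex of G to a vertex of H (just x) or deletes it (nothing);
-- branch sets are nonempty and connected; every edge of H joins two distinct
-- branch sets that are joined by an edge of G.
record MinorModel (G H : WGraph) : Set where
  field
    β         : Fin (size G) → Maybe (Fin (size H))
    nonempty  : ∀ x → ∃[ u ] β u ≡ just x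
    connected : ∀ x u v → β u ≡ just x → β v ≡ just x
                → WalkIn G (λ w → β w ≡ just x) u v
    edgesOK   : ∀ x y l → (x , y , l) ∈ edges H
                → x ≢ y × ∃[ u ] ∃[ v ] (β u ≡ just x × β v ≡ just y × Adj₀ G u v)

record DPMinor (G : WGraph) {k : ℕ} (τ : Fin k → Fin (size G)) (H : WGraph) : Set where
  field
    model    : MinorModel G H
    φ        : Fin k → Fin (size H)
    survive  : ∀ i → MinorModel.β model (τ i) ≡ just (φ i)
    φ-inj    : Injective _≡_ _≡_ φ
    nonneg   : NonNeg H
    preserve : ∀ i j d → IsDist G (τ i) (τ j) d → IsDist H (φ i) (φ j) d

-- Take the caterpillar with unit edge lengths: a path L = p₀, …, p_{k−1} = R with a
-- pendant leg at each of its k − 2 inner vertices, the terminals being L, R and the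
-- leg ends; it has 2k − 2 vertices.  In a distance-preserving minor, a geodesic between
-- two terminals on different sides of an inner vertex S must run through the branch
-- set of S.  So S is not deleted; S is not merged with a terminal t, since for
-- terminals x, y separated by S that would force d(x, t) + d(t, y) ≤ d(x, y); and two
-- adjacent inner vertices are not merged, since the geodesics leg_b–L and leg_{b+1}–R
-- would then cross and give d(leg_b, R) + d(leg_{b+1}, L) ≤ d(leg_b, L) + d(leg_{b+1}, R).
-- All these inequalities fail in the caterpillar, so the model is injective on
-- vertices.  This gives the bound for every k ≥ 3; for k ≤ 2 it follows from
-- injectivity on the terminals.
module Submission where

open import Defs
open import Data.Nat as ℕ using (ℕ; zero; suc; z≤n; s≤s; _+_; _^_; _*_; _∸_; _≤_; _<_)
import Data.Nat.Properties as ℕₚ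
open import Data.Nat.Solver using (module +-*-Solver)
open import Data.Fin as Fin using (Fin; zero; suc; toℕ; fromℕ; inject₁; inject≤; _↑ˡ_; _↑ʳ_)
import Data.Fin.Properties as Finₚ
open import Data.Rational as ℚ using (ℚ; 0ℚ; 1ℚ)
import Data.Rational.Properties as ℚₚ
open import Algebra.Bundles using (CommutativeMonoid)
import Algebra.Properties.CommutativeSemigroup as CommSemigroupProperties
open import Data.Bool using (Bool; true; false)
open import Data.Maybe using (just)
open import Data.Maybe.Properties using (just-injective)
import Data.Maybe.Properties as Maybeₚ
open import Data.Product using (Σ; ∃-syntax; _×_; _,_; proj₁; proj₂)
open import Data.Sum using (_⊎_; inj₁; inj₂; [_,_])
open import Data.Empty using (⊥; ⊥-elim)
open import Data.Unit using (⊤; tt)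
open import Data.List using (_++_; tabulate)
open import Data.List.Membership.Propositional using (_∈_)
open import Data.List.Relation.Unary.AllPairs using (AllPairs)
open import Data.List.Membership.Propositional.Properties using (∈-++⁻; ∈-++⁺ˡ; ∈-++⁺ʳ; ∈-tabulate⁺; ∈-tabulate⁻)
import Data.List.Relation.Unary.All.Properties as Allₚ
import Data.List.Relation.Unary.AllPairs.Properties as AllPairsₚ
open import Relation.Nullary using (¬_; yes; no; does)
open import Relation.Nullary.Decidable using (dec-true; dec-false)
open import Relation.Binary.PropositionalEquality hiding ([_])
open import Function using (_∘_)
open import Function.Definitions using (Injective)

toℚ : ℕ → ℚ
toℚ zero    = 0ℚ
toℚ (suc n) = toℚ n ℚ.+ 1ℚ

toℚ-+ : ∀ a b → toℚ (a + b) ≡ toℚ a ℚ.+ toℚ b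
toℚ-+ zero    b = sym (ℚₚ.+-identityˡ (toℚ b))
toℚ-+ (suc a) b = begin
  toℚ (a + b) ℚ.+ 1ℚ        ≡⟨ cong (ℚ._+ 1ℚ) (toℚ-+ a b) ⟩
  (toℚ a ℚ.+ toℚ b) ℚ.+ 1ℚ  ≡⟨ ℚₚ.+-assoc (toℚ a) (toℚ b) 1ℚ ⟩
  toℚ a ℚ.+ (toℚ b ℚ.+ 1ℚ)  ≡⟨ cong (toℚ a ℚ.+_) (ℚₚ.+-comm (toℚ b) 1ℚ) ⟩
  toℚ a ℚ.+ (1ℚ ℚ.+ toℚ b)  ≡⟨ ℚₚ.+-assoc (toℚ a) 1ℚ (toℚ b) ⟨
  (toℚ a ℚ.+ 1ℚ) ℚ.+ toℚ b  ∎
  where open ≡-Reasoning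

toℚ-suc : ∀ n → 1ℚ ℚ.+ toℚ n ≡ toℚ (suc n)
toℚ-suc n = ℚₚ.+-comm 1ℚ (toℚ n)

toℚ-nonneg : ∀ n → 0ℚ ℚ.≤ toℚ n
toℚ-nonneg zero    = ℚₚ.≤-refl
toℚ-nonneg (suc n) = ℚₚ.+-mono-≤ (toℚ-nonneg n) (ℚₚ.nonNegative⁻¹ 1ℚ)

toℚ-mono-≤ : ∀ {a b} → a ≤ b → toℚ a ℚ.≤ toℚ b
toℚ-mono-≤ {b = b} z≤n = toℚ-nonneg b
toℚ-mono-≤ (s≤s p) = ℚₚ.+-monoˡ-≤ 1ℚ (toℚ-mono-≤ p)

toℚ-mono-< : ∀ {a b} → a < b → toℚ a ℚ.< toℚ b
toℚ-mono-< {a} a<b = ℚₚ.<-≤-trans toℚ<toℚ-suc (toℚ-mono-≤ a<b)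
  where
  toℚ<toℚ-suc : toℚ a ℚ.< toℚ a ℚ.+ 1ℚ
  toℚ<toℚ-suc = subst (ℚ._< toℚ a ℚ.+ 1ℚ) (ℚₚ.+-identityʳ (toℚ a))
                      (ℚₚ.+-monoʳ-< (toℚ a) (ℚₚ.positive⁻¹ 1ℚ))

≤⇒≯ : ∀ {p q} → p ℚ.≤ q → ¬ q ℚ.< p
≤⇒≯ p≤q q<p = ℚₚ.<-irrefl refl (ℚₚ.<-≤-trans q<p p≤q)

does-<?-suc : ∀ {t x} → x ≢ t → does (t ℕ.<? x) ≡ does (t ℕ.<? suc x)
does-<?-suc {t} {x} x≢t with t ℕ.<? x
... | yes t<x = trans (dec-true (t ℕ.<? x) t<x) (sym (dec-true (t ℕ.<? suc x) (ℕₚ.m<n⇒m<1+n t<x)))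
... | no  t≮x = trans (dec-false (t ℕ.<? x) t≮x) (sym (dec-false (t ℕ.<? suc x) t≮1+x))
  where
  t≮1+x : ¬ t < suc x
  t≮1+x t<1+x = t≮x (ℕₚ.≤∧≢⇒< (ℕₚ.≤-pred t<1+x) (x≢t ∘ sym))

toℚ-+-≰ : ∀ x y {z} → z < x + y → ¬ (toℚ x ℚ.+ toℚ y ℚ.≤ toℚ z)
toℚ-+-≰ x y z<x+y le = ≤⇒≯ le (subst (_ ℚ.<_) (toℚ-+ x y) (toℚ-mono-< z<x+y))

toℚ-+-≰-+ : ∀ x y z w → z + w < x + y → ¬ (toℚ x ℚ.+ toℚ y ℚ.≤ toℚ z ℚ.+ toℚ w)
toℚ-+-≰-+ x y z w z+w<x+y le =
  ≤⇒≯ le (subst₂ ℚ._<_ (toℚ-+ z w) (toℚ-+ x y) (toℚ-mono-< z+w<x+y))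

fromℕ⊎inject₁ : ∀ {n} (i : Fin (suc n)) → i ≡ fromℕ n ⊎ ∃[ j ] i ≡ inject₁ j
fromℕ⊎inject₁ {zero}  zero    = inj₁ refl
fromℕ⊎inject₁ {suc n} zero    = inj₂ (zero , refl)
fromℕ⊎inject₁ {suc n} (suc i) with fromℕ⊎inject₁ i
... | inj₁ i≡n       = inj₁ (cong suc i≡n)
... | inj₂ (j , i≡j) = inj₂ (suc j , cong suc i≡j)

argmax : ∀ {n} (f : Fin (suc n) → ℕ) → ∃[ i ] ∀ j → f j ≤ f i
argmax {zero}  f = zero , λ { zero → ℕₚ.≤-refl }
argmax {suc n} f with argmax (f ∘ suc)
... | i , max with f zero ℕ.≤? f (suc i)
...   | yes f0≤ = suc i , λ { zero → f0≤ ; (suc j) → max j }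
...   | no  f0≰ = zero , λ { zero → ℕₚ.≤-refl ; (suc j) → ℕₚ.≤-trans (max j) (ℕₚ.<⇒≤ (ℕₚ.≰⇒> f0≰)) }

module _ (G : WGraph) where

  Adj-sym : ∀ {u v l} → Adj G u v l → Adj G v u l
  Adj-sym (inj₁ e) = inj₂ e
  Adj-sym (inj₂ e) = inj₁ e

  Adj₀-sym : ∀ {u v} → Adj₀ G u v → Adj₀ G v u
  Adj₀-sym (l , a) = l , Adj-sym a

  Walk-++ : ∀ {u v w d e} → Walk G u v d → Walk G v w e → Walk G u w (d ℚ.+ e)
  Walk-++ {e = e} here W = subst (Walk G _ _) (sym (ℚₚ.+-identityˡ e)) W
  Walk-++ {e = e} (step {l = l} {d = d} a W) W′ =
    subst (Walk G _ _) (sym (ℚₚ.+-assoc l d e)) (step a (Walk-++ W W′))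

  Walk-reverse : ∀ {u v d} → Walk G u v d → Walk G v u d
  Walk-reverse here = here
  Walk-reverse (step {l = l} {d = d} a W) =
    subst (Walk G _ _) (trans (cong (d ℚ.+_) (ℚₚ.+-identityʳ l)) (ℚₚ.+-comm d l))
      (Walk-++ (Walk-reverse W) (step (Adj-sym a) here))

  IsDist-sym : ∀ {u v d} → IsDist G u v d → IsDist G v u d
  IsDist-sym (W , min) = Walk-reverse W , λ d′ W′ → min d′ (Walk-reverse W′)

  WalkIn-head : ∀ {P u v} → WalkIn G P u v → P u
  WalkIn-head (nil p)      = p
  WalkIn-head (cons p _ _) = p

  WalkIn-++ : ∀ {P u v w} → WalkIn G P u v → WalkIn G P v w → WalkIn G P u w
  WalkIn-++ (nil _)      W′ = W′
  WalkIn-++ (cons p a W) W′ = cons p a (WalkIn-++ W W′)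

  WalkIn-reverse : ∀ {P u v} → WalkIn G P u v → WalkIn G P v u
  WalkIn-reverse (nil p)      = nil p
  WalkIn-reverse (cons p a W) =
    WalkIn-++ (WalkIn-reverse W) (cons (WalkIn-head W) (Adj₀-sym a) (nil p))

  Walk⇒WalkIn : ∀ {u v d} → Walk G u v d → WalkIn G (λ _ → ⊤) u v
  Walk⇒WalkIn here       = nil tt
  Walk⇒WalkIn (step a W) = cons tt (_ , a) (Walk⇒WalkIn W)

  walk-from-start : ∀ {n} (p : Fin (suc n) → Fin (size G))
                  → (∀ i → Adj G (p (inject₁ i)) (p (suc i)) 1ℚ)
                  → ∀ i → Walk G (p zero) (p i) (toℚ (toℕ i))
  walk-from-start         p e zero    = here
  walk-from-start {suc n} p e (suc i) =
    subst (Walk G _ _) (toℚ-suc (toℕ i)) (step (e zero) (walk-from-start (p ∘ suc) (e ∘ suc) i))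

  walk-to-end : ∀ {n} (p : Fin (suc n) → Fin (size G))
              → (∀ i → Adj G (p (inject₁ i)) (p (suc i)) 1ℚ)
              → ∀ i → Walk G (p i) (p (fromℕ n)) (toℚ (n ∸ toℕ i))
  walk-to-end {zero}  p e zero    = here
  walk-to-end {suc n} p e zero    =
    subst (Walk G _ _) (toℚ-suc n) (step (e zero) (walk-to-end (p ∘ suc) (e ∘ suc) zero))
  walk-to-end {suc n} p e (suc i) = walk-to-end (p ∘ suc) (e ∘ suc) i

  WalkVia : Fin (size G) → Fin (size G) → Fin (size G) → ℚ → Set
  WalkVia u x v d = Σ ℚ λ p → Σ ℚ λ q → Walk G u x p × Walk G x v q × p ℚ.+ q ≡ d

  Separates : Fin (size G) → (Fin (size G) → Bool) → Set
  Separates w P = ∀ u v → Adj₀ G u v → u ≢ w → v ≢ w → P u ≡ P v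

  module _ (f : Fin (size G) → ℕ)
           (f-Lipschitz : ∀ {u w l} → Adj G u w l → toℚ (f w) ℚ.≤ toℚ (f u) ℚ.+ l) where

    Walk-potential : ∀ {u v d} → Walk G u v d → toℚ (f v) ℚ.≤ toℚ (f u) ℚ.+ d
    Walk-potential {u} here = ℚₚ.≤-reflexive (sym (ℚₚ.+-identityʳ (toℚ (f u))))
    Walk-potential {u} {v} (step {w = w} {l = l} {d = d} a W) = begin
      toℚ (f v)                  ≤⟨ Walk-potential W ⟩
      toℚ (f w) ℚ.+ d            ≤⟨ ℚₚ.+-monoˡ-≤ d (f-Lipschitz a) ⟩
      (toℚ (f u) ℚ.+ l) ℚ.+ d    ≡⟨ ℚₚ.+-assoc (toℚ (f u)) l d ⟩
      toℚ (f u) ℚ.+ (l ℚ.+ d)    ∎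
      where open ℚₚ.≤-Reasoning

    Walk-potential-from-zero : ∀ {u v d} → f u ≡ 0 → Walk G u v d → toℚ (f v) ℚ.≤ d
    Walk-potential-from-zero {v = v} {d = d} fu≡0 W =
      subst (toℚ (f v) ℚ.≤_) (trans (cong (λ z → toℚ z ℚ.+ d) fu≡0) (ℚₚ.+-identityˡ d))
        (Walk-potential W)

module _ {G H : WGraph} (M : MinorModel G H) where
  open MinorModel M

  private
    avoids : ∀ {u w y} → β u ≡ just y → β w ≢ just y → u ≢ w
    avoids βu βw≢ u≡w = βw≢ (trans (cong β (sym u≡w)) βu)

  branch-set-one-sided : ∀ {w P} → Separates G w P → ∀ {y u v} → β w ≢ just y
                       → WalkIn G (λ h → β h ≡ just y) u v → P u ≡ P v
  branch-set-one-sided sep βw≢ (nil _)         = refl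
  branch-set-one-sided sep βw≢ (cons βu a W) =
    trans (sep _ _ a (avoids βu βw≢) (avoids (WalkIn-head G W) βw≢))
          (branch-set-one-sided sep βw≢ W)

  lift-edge : ∀ {y y′ l} → Adj H y y′ l → ∃[ u ] ∃[ v ] (β u ≡ just y × β v ≡ just y′ × Adj₀ G u v)
  lift-edge (inj₁ e) with edgesOK _ _ _ e
  ... | _ , u , v , βu , βv , a = u , v , βu , βv , a
  lift-edge (inj₂ e) with edgesOK _ _ _ e
  ... | _ , u , v , βu , βv , a = v , u , βv , βu , Adj₀-sym G a

  -- Branch sets are connected and edges of H lift to edges of G, so a walk of H
  -- can only change the side of G it lies over inside the branch set of w.
  walk-through-cut : ∀ {w P} → Separates G w P → ∀ {y z d} → Walk H y z d
                   → ∀ {g g′} → β g ≡ just y → β g′ ≡ just z → P g ≢ P g′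
                   → ∃[ x ] (β w ≡ just x × WalkVia H y x z d)
  walk-through-cut {w} sep {y} {d = d} W βg βg′ P≢ with Maybeₚ.≡-dec Fin._≟_ (β w) (just y)
  ... | yes βw = y , βw , 0ℚ , d , here , W , ℚₚ.+-identityˡ d
  walk-through-cut sep here βg βg′ P≢ | no βw≢ =
    ⊥-elim (P≢ (branch-set-one-sided sep βw≢ (connected _ _ _ βg βg′)))
  walk-through-cut {w} {P} sep (step {w = y′} {l = l} {d = d′} a W) {g} {g′} βg βg′ P≢ | no βw≢
    with lift-edge a | Maybeₚ.≡-dec Fin._≟_ (β w) (just y′)
  ... | _ , _ , _ , _ , _ | yes βw = y′ , βw , l ℚ.+ 0ℚ , d′ , step a here , W ,
                                      cong (ℚ._+ d′) (ℚₚ.+-identityʳ l)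
  ... | u , v , βu , βv , uv | no βw≢′ with walk-through-cut sep W βv βg′ Pv≢Pg′
    where
    Pv≢Pg′ : P v ≢ P g′
    Pv≢Pg′ Pv≡Pg′ = P≢ (begin
      P g  ≡⟨ branch-set-one-sided sep βw≢ (connected _ _ _ βg βu) ⟩
      P u  ≡⟨ sep _ _ uv (avoids βu βw≢) (avoids βv βw≢′) ⟩
      P v  ≡⟨ Pv≡Pg′ ⟩
      P g′ ∎)
      where open ≡-Reasoning
  ... | x , βw , p , q , W₁ , W₂ , p+q≡d′ =
    x , βw , l ℚ.+ p , q , step a W₁ , W₂ , trans (ℚₚ.+-assoc l p q) (cong (l ℚ.+_) p+q≡d′)

  size-≤ : (∀ u → ∃[ x ] β u ≡ just x)
         → (∀ {u v x} → Adj₀ G u v → β u ≡ just x → β v ≡ just x → ⊥)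
         → size G ≤ size H
  size-≤ survives uncontracted = Finₚ.injective⇒≤ ψ-injective
    where
    ψ : Fin (size G) → Fin (size H)
    ψ u = proj₁ (survives u)
    ψ-injective : Injective _≡_ _≡_ ψ
    ψ-injective {u} {v} ψu≡ψv
      with connected (ψ u) u v (proj₂ (survives u)) (trans (proj₂ (survives v)) (cong just (sym ψu≡ψv)))
    ... | nil _      = refl
    ... | cons _ a W = ⊥-elim (uncontracted a (proj₂ (survives u)) (WalkIn-head G W))

module _ {G H : WGraph} {k : ℕ} {τ : Fin k → Fin (size G)} (D : DPMinor G τ H) where
  open DPMinor D
  open MinorModel model

  private
    geodesic-through-cut : ∀ {w P} → Separates G w P → ∀ i j → P (τ i) ≢ P (τ j)
                         → ∀ {d} → IsDist G (τ i) (τ j) d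
                         → ∃[ x ] (β w ≡ just x × WalkVia H (φ i) x (φ j) d)
    geodesic-through-cut sep i j P≢ {d} dist =
      walk-through-cut model sep (proj₁ (preserve i j d dist)) (survive i) (survive j) P≢

  cut-vertex-survives : ∀ {w P} → Separates G w P → ∀ i j → P (τ i) ≢ P (τ j)
                      → ∀ {d} → IsDist G (τ i) (τ j) d → ∃[ x ] β w ≡ just x
  cut-vertex-survives sep i j P≢ dist with geodesic-through-cut sep i j P≢ dist
  ... | x , βw , _ = x , βw

  cut-merged-with-terminal : ∀ {w P} → Separates G w P → ∀ i j t → P (τ i) ≢ P (τ j)
                           → β w ≡ just (φ t)
                           → ∀ {dij dit dtj} → IsDist G (τ i) (τ j) dij
                           → IsDist G (τ i) (τ t) dit → IsDist G (τ t) (τ j) dtj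
                           → dit ℚ.+ dtj ℚ.≤ dij
  cut-merged-with-terminal sep i j t P≢ βw≡φt {dit = dit} {dtj} ij it tj
    with geodesic-through-cut sep i j P≢ ij
  ... | x , βw , p , q , W₁ , W₂ , p+q≡d with just-injective (trans (sym βw) βw≡φt)
  ... | refl = subst (dit ℚ.+ dtj ℚ.≤_) p+q≡d
                 (ℚₚ.+-mono-≤ (proj₂ (preserve i t _ it) p W₁)
                              (proj₂ (preserve t j _ tj) q W₂))

  -- two geodesics through the common image of two cut vertices can swap their second halves
  cuts-merged : ∀ {w P w′ P′} → Separates G w P → Separates G w′ P′ → β w ≡ β w′
              → ∀ a b c e → P (τ a) ≢ P (τ b) → P′ (τ c) ≢ P′ (τ e)
              → ∀ {dab dce dae dcb} → IsDist G (τ a) (τ b) dab → IsDist G (τ c) (τ e) dce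
              → IsDist G (τ a) (τ e) dae → IsDist G (τ c) (τ b) dcb
              → dae ℚ.+ dcb ℚ.≤ dab ℚ.+ dce
  cuts-merged sep sep′ βw≡βw′ a b c e P≢ P′≢ {dab} {dce} {dae} {dcb} ab ce ae cb
    with geodesic-through-cut sep a b P≢ ab | geodesic-through-cut sep′ c e P′≢ ce
  ... | x , βw , p , q , Wax , Wxb , p+q≡dab | x′ , βw′ , p′ , q′ , Wcx , Wxe , p′+q′≡dce
    with just-injective (trans (sym βw) (trans βw≡βw′ βw′))
  ... | refl = subst (dae ℚ.+ dcb ℚ.≤_) swap
                 (ℚₚ.+-mono-≤ (proj₂ (preserve a e _ ae) _ (Walk-++ H Wax Wxe))
                              (proj₂ (preserve c b _ cb) _ (Walk-++ H Wcx Wxb)))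
    where
    open CommSemigroupProperties (CommutativeMonoid.commutativeSemigroup ℚₚ.+-0-commutativeMonoid)
      using (interchange)
    swap : (p ℚ.+ q′) ℚ.+ (p′ ℚ.+ q) ≡ dab ℚ.+ dce
    swap = begin
      (p ℚ.+ q′) ℚ.+ (p′ ℚ.+ q)  ≡⟨ interchange p q′ p′ q ⟩
      (p ℚ.+ p′) ℚ.+ (q′ ℚ.+ q)  ≡⟨ cong ((p ℚ.+ p′) ℚ.+_) (ℚₚ.+-comm q′ q) ⟩
      (p ℚ.+ p′) ℚ.+ (q ℚ.+ q′)  ≡⟨ interchange p q p′ q′ ⟨
      (p ℚ.+ q) ℚ.+ (p′ ℚ.+ q′)  ≡⟨ cong₂ ℚ._+_ p+q≡dab p′+q′≡dce ⟩
      dab ℚ.+ dce                ∎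
      where open ≡-Reasoning

-- A vertex of maximal rank on a cycle would have two distinct parents.
module _ (G : WGraph) (rank : Fin (size G) → ℕ)
         (rank-increasing : ∀ {u v l} → (u , v , l) ∈ edges G → rank u < rank v)
         (unique-parent : ∀ {u u′ v l l′} → (u , v , l) ∈ edges G → (u′ , v , l′) ∈ edges G → u ≡ u′)
         where

  private
    parent : ∀ {u v} → Adj₀ G u v → rank v ≤ rank u → ∃[ l ] (v , u , l) ∈ edges G
    parent (l , inj₁ e) v≤u = ⊥-elim (ℕₚ.<⇒≱ (rank-increasing e) v≤u)
    parent (l , inj₂ e) _   = l , e

    module _ (C : Cycle G) where
      open Cycle C

      neighbours : ∀ i → ∃[ i⁻ ] ∃[ i⁺ ] (i⁻ ≢ i⁺ × Adj₀ G (c i) (c i⁻) × Adj₀ G (c i) (c i⁺))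
      neighbours zero = fromℕ (suc (suc len)) , suc zero , (λ ()) , Adj₀-sym G close , consec zero
      neighbours (suc i) with fromℕ⊎inject₁ {suc (suc len)} (suc i)
      ... | inj₁ i≡last = inject₁ i , zero , i≢0 , Adj₀-sym G (consec i) ,
                          subst (λ z → Adj₀ G (c z) (c zero)) (sym i≡last) close
        where
        i≢0 : inject₁ i ≢ zero
        i≢0 e = ℕₚ.1+n≢0 (begin
          suc len                ≡⟨ Finₚ.toℕ-fromℕ (suc len) ⟨
          toℕ (fromℕ (suc len))  ≡⟨ cong toℕ (Finₚ.suc-injective i≡last) ⟨
          toℕ i                  ≡⟨ Finₚ.toℕ-inject₁ i ⟨
          toℕ (inject₁ i)        ≡⟨ cong toℕ e ⟩
          0                      ∎)
          where open ≡-Reasoning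
      ... | inj₂ (j , i≡j) = inject₁ i , suc j , i≢j , Adj₀-sym G (consec i) ,
                             subst (λ z → Adj₀ G (c z) (c (suc j))) (sym i≡j) (consec j)
        where
        i≢j : inject₁ i ≢ suc j
        i≢j e = ℕₚ.<-irrefl toℕi≡2+toℕi (ℕₚ.m<n+m (toℕ i) (s≤s z≤n))
          where
          toℕi≡2+toℕi : toℕ i ≡ 2 + toℕ i
          toℕi≡2+toℕi = trans (sym (Finₚ.toℕ-inject₁ i)) (trans (cong toℕ e)
                          (cong suc (trans (sym (Finₚ.toℕ-inject₁ j)) (sym (cong toℕ i≡j)))))

      no-cycle : ⊥
      no-cycle with argmax (rank ∘ c)
      ... | i , max with neighbours i
      ...   | i⁻ , i⁺ , i⁻≢i⁺ , a⁻ , a⁺ with parent a⁻ (max i⁻) | parent a⁺ (max i⁺)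
      ...     | _ , e⁻ | _ , e⁺ = i⁻≢i⁺ (inj (unique-parent e⁻ e⁺))

  acyclic : ¬ Cycle G
  acyclic = no-cycle

-- spine a is the path vertex p_a (a ≤ m + 2); leg j hangs off S j = p_{j+1}.
module Caterpillar (m : ℕ) where

  N : ℕ
  N = (3 + m) + (1 + m)

  spine : Fin (3 + m) → Fin N
  spine a = a ↑ˡ (1 + m)

  leg : Fin (1 + m) → Fin N
  leg j = (3 + m) ↑ʳ j

  attach : Fin (1 + m) → Fin (3 + m)
  attach j = suc (inject₁ j)

  S : Fin (1 + m) → Fin N
  S j = spine (attach j)

  L R : Fin N
  L = spine zero
  R = spine (fromℕ (2 + m))

  spine-edge : Fin (2 + m) → Fin N × Fin N × ℚ
  spine-edge a = spine (inject₁ a) , spine (suc a) , 1ℚ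

  leg-edge : Fin (1 + m) → Fin N × Fin N × ℚ
  leg-edge j = S j , leg j , 1ℚ

  G : WGraph
  G = mkG N (tabulate spine-edge ++ tabulate leg-edge)

  data Edge : Fin N → Fin N → Set where
    spineᵉ : ∀ a → Edge (spine (inject₁ a)) (spine (suc a))
    legᵉ   : ∀ j → Edge (S j) (leg j)

  Edge⇒∈ : ∀ {u v} → Edge u v → (u , v , 1ℚ) ∈ edges G
  Edge⇒∈ (spineᵉ a) = ∈-++⁺ˡ (∈-tabulate⁺ {f = spine-edge} a)
  Edge⇒∈ (legᵉ j)   = ∈-++⁺ʳ (tabulate spine-edge) (∈-tabulate⁺ {f = leg-edge} j)

  ∈⇒Edge : ∀ {u v l} → (u , v , l) ∈ edges G → Edge u v × l ≡ 1ℚ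
  ∈⇒Edge e with ∈-++⁻ (tabulate spine-edge) e
  ... | inj₁ e′ with ∈-tabulate⁻ {f = spine-edge} e′
  ...   | a , refl = spineᵉ a , refl
  ∈⇒Edge e | inj₂ e′ with ∈-tabulate⁻ {f = leg-edge} e′
  ...   | j , refl = legᵉ j , refl

  Adj⇒Edge : ∀ {u v l} → Adj G u v l → (Edge u v ⊎ Edge v u) × l ≡ 1ℚ
  Adj⇒Edge (inj₁ e) with ∈⇒Edge e
  ... | uv , l≡1 = inj₁ uv , l≡1
  Adj⇒Edge (inj₂ e) with ∈⇒Edge e
  ... | vu , l≡1 = inj₂ vu , l≡1

  spine-adj : ∀ a → Adj G (spine (inject₁ a)) (spine (suc a)) 1ℚ
  spine-adj a = inj₁ (Edge⇒∈ (spineᵉ a))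

  leg-adj : ∀ j → Adj G (S j) (leg j) 1ℚ
  leg-adj j = inj₁ (Edge⇒∈ (legᵉ j))

  data View : Fin N → Set where
    spineᵛ : ∀ a → View (spine a)
    legᵛ   : ∀ j → View (leg j)

  view : ∀ v → View v
  view v = subst View (Finₚ.join-splitAt (3 + m) (1 + m) v) (view-split (Fin.splitAt (3 + m) v))
    where
    view-split : ∀ s → View (Fin.join (3 + m) (1 + m) s)
    view-split (inj₁ a) = spineᵛ a
    view-split (inj₂ j) = legᵛ j

  caseᵛ : {A : Set} → (Fin (3 + m) → A) → (Fin (1 + m) → A) → Fin N → A
  caseᵛ f g v = [ f , g ] (Fin.splitAt (3 + m) v)

  caseᵛ-spine : ∀ {A : Set} (f : Fin (3 + m) → A) g a → caseᵛ f g (spine a) ≡ f a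
  caseᵛ-spine f g a = cong [ f , g ] (Finₚ.splitAt-↑ˡ (3 + m) a (1 + m))

  caseᵛ-leg : ∀ {A : Set} (f : Fin (3 + m) → A) g j → caseᵛ f g (leg j) ≡ g j
  caseᵛ-leg f g j = cong [ f , g ] (Finₚ.splitAt-↑ʳ (3 + m) (1 + m) j)

  spine-injective : ∀ {a b} → spine a ≡ spine b → a ≡ b
  spine-injective = Finₚ.↑ˡ-injective (1 + m) _ _

  leg-injective : ∀ {j j′} → leg j ≡ leg j′ → j ≡ j′
  leg-injective = Finₚ.↑ʳ-injective (3 + m) _ _

  spine<leg : ∀ a j → toℕ (spine a) < toℕ (leg j)
  spine<leg a j = subst₂ _<_ (sym (Finₚ.toℕ-↑ˡ a (1 + m))) (sym (Finₚ.toℕ-↑ʳ (3 + m) j))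
                    (ℕₚ.<-≤-trans (Finₚ.toℕ<n a) (ℕₚ.m≤m+n (3 + m) (toℕ j)))

  spine≢leg : ∀ {a j} → spine a ≢ leg j
  spine≢leg {a} {j} e = ℕₚ.<⇒≢ (spine<leg a j) (cong toℕ e)

  Edge-rank : ∀ {u v} → Edge u v → toℕ u < toℕ v
  Edge-rank (spineᵉ a) = subst₂ _<_ (sym (trans (Finₚ.toℕ-↑ˡ (inject₁ a) (1 + m)) (Finₚ.toℕ-inject₁ a)))
                                    (sym (Finₚ.toℕ-↑ˡ (suc a) (1 + m))) (ℕₚ.n<1+n (toℕ a))
  Edge-rank (legᵉ j)   = spine<leg (attach j) j

  Edge-parent-unique : ∀ {u v u′ v′} → Edge u v → Edge u′ v′ → v ≡ v′ → u ≡ u′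
  Edge-parent-unique (spineᵉ a) (spineᵉ b) e = cong (spine ∘ inject₁) (Finₚ.suc-injective (spine-injective e))
  Edge-parent-unique (spineᵉ a) (legᵉ j)   e = ⊥-elim (spine≢leg e)
  Edge-parent-unique (legᵉ j)   (spineᵉ a) e = ⊥-elim (spine≢leg (sym e))
  Edge-parent-unique (legᵉ j)   (legᵉ j′)  e = cong S (leg-injective e)

  Edges-not-parallel : ∀ {u v u′ v′} → Edge u v → Edge u′ v′ → v ≢ v′
                     → ¬ SameEnds G (u , v , 1ℚ) (u′ , v′ , 1ℚ)
  Edges-not-parallel _  _  v≢v′ (inj₁ (_ , v≡v′))    = v≢v′ v≡v′
  Edges-not-parallel {v = v} {v′ = v′} uv u′v′ _ (inj₂ (u≡v′ , v≡u′)) =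
    ℕₚ.<-asym (subst (_< toℕ v) (cong toℕ u≡v′) (Edge-rank uv))
              (subst (_< toℕ v′) (cong toℕ (sym v≡u′)) (Edge-rank u′v′))

  walk-from-L : ∀ v → ∃[ d ] Walk G L v d
  walk-from-L v with view v
  ... | spineᵛ a = _ , walk-from-start G spine spine-adj a
  ... | legᵛ j   = _ , Walk-++ G (walk-from-start G spine spine-adj (attach j)) (step (leg-adj j) here)

  is-tree : IsTree G
  is-tree = L , (no-loops , no-parallel) , connected , acyclic G toℕ
              (λ e → Edge-rank (proj₁ (∈⇒Edge e)))
              (λ e e′ → Edge-parent-unique (proj₁ (∈⇒Edge e)) (proj₁ (∈⇒Edge e′)) refl)
    where
    no-loops : ∀ u v l → (u , v , l) ∈ edges G → u ≢ v
    no-loops u v l e u≡v = ℕₚ.<-irrefl (cong toℕ u≡v) (Edge-rank (proj₁ (∈⇒Edge e)))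
    no-parallel : AllPairs (λ e f → ¬ SameEnds G e f) (edges G)
    no-parallel = AllPairsₚ.++⁺
      (AllPairsₚ.tabulate⁺ {f = spine-edge} λ a≢b →
         Edges-not-parallel (spineᵉ _) (spineᵉ _) (a≢b ∘ Finₚ.suc-injective ∘ spine-injective))
      (AllPairsₚ.tabulate⁺ {f = leg-edge} λ j≢j′ →
         Edges-not-parallel (legᵉ _) (legᵉ _) (j≢j′ ∘ leg-injective))
      (Allₚ.tabulate⁺ {f = spine-edge} λ a → Allₚ.tabulate⁺ {f = leg-edge} λ j →
         Edges-not-parallel (spineᵉ a) (legᵉ j) spine≢leg)
    connected : Connected G
    connected u v = WalkIn-++ G (WalkIn-reverse G (Walk⇒WalkIn G (proj₂ (walk-from-L u))))
                                (Walk⇒WalkIn G (proj₂ (walk-from-L v)))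

  nonneg : NonNeg G
  nonneg = Allₚ.++⁺ (Allₚ.tabulate⁺ {f = spine-edge} λ _ → ℚₚ.nonNegative⁻¹ 1ℚ)
                    (Allₚ.tabulate⁺ {f = leg-edge} λ _ → ℚₚ.nonNegative⁻¹ 1ℚ)

  Near : ℕ → ℕ → Set
  Near x y = y ≤ suc x × x ≤ suc y

  Near-cong : ∀ {x x′ y y′} → x ≡ x′ → y ≡ y′ → Near x y → Near x′ y′
  Near-cong refl refl near = near

  Near-suc : ∀ x → Near x (suc x)
  Near-suc x = ℕₚ.≤-refl , ℕₚ.m≤n⇒m≤1+n (ℕₚ.n≤1+n x)

  Near-∸suc : ∀ n x → Near (n ∸ x) (n ∸ suc x)
  Near-∸suc n x = ℕₚ.m≤n⇒m≤1+n (ℕₚ.∸-monoʳ-≤ n (ℕₚ.n≤1+n x)) , ∸≤suc∸suc n x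
    where
    ∸≤suc∸suc : ∀ n x → n ∸ x ≤ suc (n ∸ suc x)
    ∸≤suc∸suc zero    zero    = z≤n
    ∸≤suc∸suc zero    (suc x) = z≤n
    ∸≤suc∸suc (suc n) zero    = ℕₚ.≤-refl
    ∸≤suc∸suc (suc n) (suc x) = ∸≤suc∸suc n x

  Lipschitz : (Fin N → ℕ) → Set
  Lipschitz f = ∀ {u v} → Edge u v → Near (f u) (f v)

  caseᵛ-Lipschitz : ∀ f g → (∀ a → Near (f (inject₁ a)) (f (suc a))) → (∀ j → Near (f (attach j)) (g j))
                  → Lipschitz (caseᵛ f g)
  caseᵛ-Lipschitz f g spine-near leg-near (spineᵉ a) =
    Near-cong (sym (caseᵛ-spine f g (inject₁ a))) (sym (caseᵛ-spine f g (suc a))) (spine-near a)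
  caseᵛ-Lipschitz f g spine-near leg-near (legᵉ j) =
    Near-cong (sym (caseᵛ-spine f g (attach j))) (sym (caseᵛ-leg f g j)) (leg-near j)

  Lipschitz-lower-bound : ∀ f → Lipschitz f → ∀ {u v n} → f u ≡ 0 → f v ≡ n
                        → ∀ d → Walk G u v d → toℚ n ℚ.≤ d
  Lipschitz-lower-bound f lip fu≡0 refl d W = Walk-potential-from-zero G f potential fu≡0 W
    where
    potential : ∀ {u w l} → Adj G u w l → toℚ (f w) ℚ.≤ toℚ (f u) ℚ.+ l
    potential a with Adj⇒Edge a
    ... | inj₁ uw , refl = toℚ-mono-≤ (proj₁ (lip uw))
    ... | inj₂ wu , refl = toℚ-mono-≤ (proj₂ (lip wu))

  toℕ-attach : ∀ j → toℕ (attach j) ≡ suc (toℕ j)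
  toℕ-attach j = cong suc (Finₚ.toℕ-inject₁ j)

  j≤m : ∀ (j : Fin (1 + m)) → toℕ j ≤ m
  j≤m j = ℕₚ.≤-pred (Finₚ.toℕ<n j)

  2+m∸attach : ∀ j → (2 + m) ∸ toℕ (attach j) ≡ suc (m ∸ toℕ j)
  2+m∸attach j = trans (cong ((2 + m) ∸_) (toℕ-attach j)) (ℕₚ.+-∸-assoc 1 (j≤m j))

  hops-L : Fin N → ℕ
  hops-L = caseᵛ toℕ (ℕ.suc ∘ toℕ ∘ attach)

  hops-R : Fin N → ℕ
  hops-R = caseᵛ (((2 + m) ∸_) ∘ toℕ) (ℕ.suc ∘ ((2 + m) ∸_) ∘ toℕ ∘ attach)

  hops-L-Lipschitz : Lipschitz hops-L
  hops-L-Lipschitz = caseᵛ-Lipschitz _ _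
    (λ a → Near-cong (sym (Finₚ.toℕ-inject₁ a)) refl (Near-suc (toℕ a)))
    (Near-suc ∘ toℕ ∘ attach)

  hops-R-Lipschitz : Lipschitz hops-R
  hops-R-Lipschitz = caseᵛ-Lipschitz _ _
    (λ a → Near-cong (cong ((2 + m) ∸_) (sym (Finₚ.toℕ-inject₁ a))) refl (Near-∸suc (2 + m) (toℕ a)))
    (Near-suc ∘ ((2 + m) ∸_) ∘ toℕ ∘ attach)

  hops-L-R : hops-L R ≡ 2 + m
  hops-L-R = trans (caseᵛ-spine toℕ (ℕ.suc ∘ toℕ ∘ attach) (fromℕ (2 + m))) (Finₚ.toℕ-fromℕ (2 + m))

  hops-L-leg : ∀ j → hops-L (leg j) ≡ 2 + toℕ j
  hops-L-leg j = trans (caseᵛ-leg toℕ (ℕ.suc ∘ toℕ ∘ attach) j) (cong suc (toℕ-attach j))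

  hops-R-R : hops-R R ≡ 0
  hops-R-R = trans (caseᵛ-spine (((2 + m) ∸_) ∘ toℕ) (ℕ.suc ∘ ((2 + m) ∸_) ∘ toℕ ∘ attach) (fromℕ (2 + m)))
                   (trans (cong ((2 + m) ∸_) (Finₚ.toℕ-fromℕ (2 + m))) (ℕₚ.n∸n≡0 (2 + m)))

  hops-R-leg : ∀ j → hops-R (leg j) ≡ 2 + (m ∸ toℕ j)
  hops-R-leg j = trans (caseᵛ-leg (((2 + m) ∸_) ∘ toℕ) (ℕ.suc ∘ ((2 + m) ∸_) ∘ toℕ ∘ attach) j)
                       (cong suc (2+m∸attach j))

  dist-L-R : IsDist G L R (toℚ (2 + m))
  dist-L-R = walk-to-end G spine spine-adj zero
           , Lipschitz-lower-bound hops-L hops-L-Lipschitz refl hops-L-R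

  dist-L-leg : ∀ j → IsDist G L (leg j) (toℚ (2 + toℕ j))
  dist-L-leg j = subst (Walk G L (leg j)) length-≡ walk
               , Lipschitz-lower-bound hops-L hops-L-Lipschitz refl (hops-L-leg j)
    where
    walk = Walk-++ G (walk-from-start G spine spine-adj (attach j)) (step (leg-adj j) here)
    length-≡ : toℚ (toℕ (attach j)) ℚ.+ (1ℚ ℚ.+ 0ℚ) ≡ toℚ (2 + toℕ j)
    length-≡ = trans (cong (toℚ (toℕ (attach j)) ℚ.+_) (ℚₚ.+-identityʳ 1ℚ))
                     (cong (toℚ ∘ suc) (toℕ-attach j))

  dist-leg-R : ∀ j → IsDist G (leg j) R (toℚ (2 + (m ∸ toℕ j)))
  dist-leg-R j = subst (Walk G (leg j) R) length-≡ walk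
               , λ d W → Lipschitz-lower-bound hops-R hops-R-Lipschitz hops-R-R (hops-R-leg j) d
                                               (Walk-reverse G W)
    where
    walk = step (Adj-sym G (leg-adj j)) (walk-to-end G spine spine-adj (attach j))
    length-≡ : 1ℚ ℚ.+ toℚ ((2 + m) ∸ toℕ (attach j)) ≡ toℚ (2 + (m ∸ toℕ j))
    length-≡ = trans (toℚ-suc ((2 + m) ∸ toℕ (attach j))) (cong (toℚ ∘ suc) (2+m∸attach j))

  foot : Fin N → Fin (3 + m)
  foot = caseᵛ (λ a → a) attach

  -- true on the component of G − S j that contains R
  beyond : Fin (1 + m) → Fin N → Bool
  beyond j v = does (toℕ (attach j) ℕ.<? toℕ (foot v))

  is-leg : Fin (1 + m) → Fin N → Bool
  is-leg j v = does (v Fin.≟ leg j)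

  Separates-by-Edge : ∀ {w P} → (∀ {u v} → Edge u v → u ≢ w → v ≢ w → P u ≡ P v) → Separates G w P
  Separates-by-Edge edge-case u v (_ , a) u≢w v≢w with Adj⇒Edge a
  ... | inj₁ uv , _ = edge-case uv u≢w v≢w
  ... | inj₂ vu , _ = sym (edge-case vu v≢w u≢w)

  beyond-spine : ∀ j a → beyond j (spine a) ≡ does (toℕ (attach j) ℕ.<? toℕ a)
  beyond-spine j a = cong (λ b → does (toℕ (attach j) ℕ.<? toℕ b)) (caseᵛ-spine (λ a → a) attach a)

  beyond-spineᵉ : ∀ j a → spine (inject₁ a) ≢ S j → beyond j (spine (inject₁ a)) ≡ beyond j (spine (suc a))
  beyond-spineᵉ j a u≢Sj = begin
    beyond j (spine (inject₁ a))                ≡⟨ beyond-spine j (inject₁ a) ⟩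
    does (toℕ (attach j) ℕ.<? toℕ (inject₁ a))  ≡⟨ cong (does ∘ (toℕ (attach j) ℕ.<?_)) (Finₚ.toℕ-inject₁ a) ⟩
    does (toℕ (attach j) ℕ.<? toℕ a)            ≡⟨ does-<?-suc a≢attach ⟩
    does (toℕ (attach j) ℕ.<? suc (toℕ a))      ≡⟨ beyond-spine j (suc a) ⟨
    beyond j (spine (suc a))                    ∎
    where
    open ≡-Reasoning
    a≢attach : toℕ a ≢ toℕ (attach j)
    a≢attach e = u≢Sj (cong spine (Finₚ.toℕ-injective (trans (Finₚ.toℕ-inject₁ a) e)))

  beyond-separates : ∀ j → Separates G (S j) (beyond j)
  beyond-separates j = Separates-by-Edge λ where
    (spineᵉ a) u≢Sj _ → beyond-spineᵉ j a u≢Sj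
    (legᵉ j′)  _    _ → cong (λ b → does (toℕ (attach j) ℕ.<? toℕ b))
                             (trans (caseᵛ-spine (λ a → a) attach (attach j′)) (sym (caseᵛ-leg (λ a → a) attach j′)))

  is-leg-false : ∀ {j v} → v ≢ leg j → is-leg j v ≡ false
  is-leg-false {j} {v} = dec-false (v Fin.≟ leg j)

  is-leg-separates : ∀ j → Separates G (S j) (is-leg j)
  is-leg-separates j = Separates-by-Edge λ where
    (spineᵉ a) _    _ → trans (is-leg-false {j} {spine (inject₁ a)} spine≢leg)
                              (sym (is-leg-false {j} {spine (suc a)} spine≢leg))
    (legᵉ j′)  u≢Sj _ → trans (is-leg-false {j} {S j′} spine≢leg)
                              (sym (is-leg-false (u≢Sj ∘ cong S ∘ leg-injective)))

  is-leg-leg : ∀ j → is-leg j (leg j) ≡ true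
  is-leg-leg j = dec-true (leg j Fin.≟ leg j) refl

  is-leg-leg≢spine : ∀ j a → is-leg j (leg j) ≢ is-leg j (spine a)
  is-leg-leg≢spine j a e with trans (sym (is-leg-leg j)) (trans e (is-leg-false {j} {spine a} spine≢leg))
  ... | ()

  beyond-R : ∀ j → beyond j R ≡ true
  beyond-R j = trans (beyond-spine j (fromℕ (2 + m))) (dec-true (toℕ (attach j) ℕ.<? toℕ (fromℕ (2 + m))) S<R)
    where
    S<R : toℕ (attach j) < toℕ (fromℕ (2 + m))
    S<R = subst₂ _<_ (sym (toℕ-attach j)) (sym (Finₚ.toℕ-fromℕ (2 + m))) (s≤s (s≤s (j≤m j)))

  beyond-L≢R : ∀ j → beyond j L ≢ beyond j R
  beyond-L≢R j e with trans e (beyond-R j)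
  ... | ()

  τ : Fin (3 + m) → Fin N
  τ zero          = L
  τ (suc zero)    = R
  τ (suc (suc j)) = leg j

  τ-injective : Injective _≡_ _≡_ τ
  τ-injective {zero}        {zero}        _ = refl
  τ-injective {zero}        {suc zero}    e with spine-injective e
  ... | ()
  τ-injective {zero}        {suc (suc _)} e = ⊥-elim (spine≢leg e)
  τ-injective {suc zero}    {zero}        e with spine-injective e
  ... | ()
  τ-injective {suc zero}    {suc zero}    _ = refl
  τ-injective {suc zero}    {suc (suc _)} e = ⊥-elim (spine≢leg e)
  τ-injective {suc (suc _)} {zero}        e = ⊥-elim (spine≢leg (sym e))
  τ-injective {suc (suc _)} {suc zero}    e = ⊥-elim (spine≢leg (sym e))
  τ-injective {suc (suc _)} {suc (suc _)} e = cong (λ j → Fin.suc (Fin.suc j)) (leg-injective e)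

  leg-detour : ∀ t → t ≤ m → 2 + m < (2 + t) + (2 + (m ∸ t))
  leg-detour t t≤m = subst (2 + m <_) (sym detour) (ℕₚ.m<n+m (2 + m) {2} (s≤s z≤n))
    where
    open +-*-Solver
    detour : (2 + t) + (2 + (m ∸ t)) ≡ 2 + (2 + m)
    detour = trans (solve 2 (λ t x → (con 2 :+ t) :+ (con 2 :+ x) := con 2 :+ (con 2 :+ (t :+ x))) refl t (m ∸ t))
                   (cong (λ z → 2 + (2 + z)) (ℕₚ.m+[n∸m]≡n t≤m))

  crossing-legs : ∀ t → suc t ≤ m → (2 + t) + (2 + (m ∸ suc t)) < (2 + (m ∸ t)) + (2 + suc t)
  crossing-legs t t<m = subst (straight <_) (sym crossing) (ℕₚ.m<n+m straight {2} (s≤s z≤n))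
    where
    open +-*-Solver
    straight = (2 + t) + (2 + (m ∸ suc t))
    crossing : (2 + (m ∸ t)) + (2 + suc t) ≡ 2 + straight
    crossing = trans (cong (λ z → (2 + z) + (2 + suc t)) (ℕₚ.+-∸-assoc 1 t<m))
      (solve 2 (λ t x → (con 2 :+ (con 1 :+ x)) :+ (con 2 :+ (con 1 :+ t)) := con 2 :+ ((con 2 :+ t) :+ (con 2 :+ x)))
             refl t (m ∸ suc t))

  module _ {H : WGraph} (D : DPMinor G τ H) where
    open DPMinor D
    open MinorModel model

    survives : ∀ v → ∃[ x ] β v ≡ just x
    survives v with view v
    ... | legᵛ j           = φ (suc (suc j)) , survive (suc (suc j))
    ... | spineᵛ zero      = φ zero , survive zero
    ... | spineᵛ (suc a) with fromℕ⊎inject₁ a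
    ...   | inj₁ refl      = φ (suc zero) , survive (suc zero)
    ...   | inj₂ (j , refl) =
      cut-vertex-survives D (beyond-separates j) zero (suc zero) (beyond-L≢R j) dist-L-R

    Edge-uncontracted : ∀ {u v x} → Edge u v → β u ≡ just x → β v ≡ just x → ⊥
    Edge-uncontracted (spineᵉ zero) βu βv =
      toℚ-+-≰ 2 (2 + m) (ℕₚ.m<n+m (2 + m) {2} (s≤s z≤n))
        (cut-merged-with-terminal D (is-leg-separates zero) (suc (suc zero)) (suc zero) zero
          (is-leg-leg≢spine zero (fromℕ (2 + m))) (trans βv (trans (sym βu) (survive zero)))
          (dist-leg-R zero) (IsDist-sym G (dist-L-leg zero)) dist-L-R)
    Edge-uncontracted (spineᵉ (suc a)) βu βv with fromℕ⊎inject₁ a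
    ... | inj₁ refl =
      toℚ-+-≰ (2 + (m ∸ toℕ (fromℕ m))) (2 + m)
        (subst (λ t → 2 + t < (2 + (m ∸ t)) + (2 + m)) (sym (Finₚ.toℕ-fromℕ m))
               (ℕₚ.m<n+m (2 + m) {2 + (m ∸ m)} (s≤s z≤n)))
        (cut-merged-with-terminal D (is-leg-separates (fromℕ m)) (suc (suc (fromℕ m))) zero (suc zero)
          (is-leg-leg≢spine (fromℕ m) zero) (trans βu (trans (sym βv) (survive (suc zero))))
          (IsDist-sym G (dist-L-leg (fromℕ m))) (dist-leg-R (fromℕ m)) (IsDist-sym G dist-L-R))
    ... | inj₂ (b , refl) =
      toℚ-+-≰-+ (2 + (m ∸ toℕ (inject₁ b))) (2 + toℕ (suc b))
                (2 + toℕ (inject₁ b)) (2 + (m ∸ toℕ (suc b)))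
        (subst (λ t → (2 + t) + (2 + (m ∸ suc (toℕ b))) < (2 + (m ∸ t)) + (2 + suc (toℕ b)))
               (sym (Finₚ.toℕ-inject₁ b)) (crossing-legs (toℕ b) (Finₚ.toℕ<n b)))
        (cuts-merged D (is-leg-separates (inject₁ b)) (is-leg-separates (suc b)) (trans βu (sym βv))
          (suc (suc (inject₁ b))) zero (suc (suc (suc b))) (suc zero)
          (is-leg-leg≢spine (inject₁ b) zero) (is-leg-leg≢spine (suc b) (fromℕ (2 + m)))
          (IsDist-sym G (dist-L-leg (inject₁ b))) (dist-leg-R (suc b))
          (dist-leg-R (inject₁ b)) (IsDist-sym G (dist-L-leg (suc b))))
    Edge-uncontracted (legᵉ j) βu βv =
      toℚ-+-≰ (2 + toℕ j) (2 + (m ∸ toℕ j)) (leg-detour (toℕ j) (j≤m j))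
        (cut-merged-with-terminal D (beyond-separates j) zero (suc zero) (suc (suc j)) (beyond-L≢R j)
          (trans βu (trans (sym βv) (survive (suc (suc j))))) dist-L-R (dist-L-leg j) (dist-leg-R j))

    uncontracted : ∀ {u v x} → Adj₀ G u v → β u ≡ just x → β v ≡ just x → ⊥
    uncontracted (_ , a) βu βv with Adj⇒Edge a
    ... | inj₁ uv , _ = Edge-uncontracted uv βu βv
    ... | inj₂ vu , _ = Edge-uncontracted vu βv βu

    minor-size : N ≤ size H
    minor-size = size-≤ model survives uncontracted

HardInstance : ℕ → ℕ → Set
HardInstance k b = Σ WGraph (λ G → IsTree G × NonNeg G
                     × Σ (Fin k → Fin (size G)) (λ τ → Injective _≡_ _≡_ τ
                     × ((H : WGraph) → DPMinor G τ H → b ≤ size H)))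

HardInstance-mono : ∀ {k b b′} → b′ ≤ b → HardInstance k b → HardInstance k b′
HardInstance-mono b′≤b (G , tree , nonneg , τ , τ-inj , bound) =
  G , tree , nonneg , τ , τ-inj , λ H D → ℕₚ.≤-trans b′≤b (bound H D)

caterpillar-instance : ∀ m → HardInstance (3 + m) (Caterpillar.N m)
caterpillar-instance m = G , is-tree , nonneg , τ , τ-injective , λ H → minor-size
  where open Caterpillar m

-- the terminals alone already force k vertices
few-terminals-instance : ∀ k → k ≤ 4 → HardInstance k k
few-terminals-instance k k≤4 =
  G , is-tree , nonneg , τ , τ-injective , λ H D → Finₚ.injective⇒≤ (DPMinor.φ-inj D)
  where
  open Caterpillar 0 using (G; is-tree; nonneg)
  τ : Fin k → Fin 4
  τ i = inject≤ i k≤4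
  τ-injective : Injective _≡_ _≡_ τ
  τ-injective = Finₚ.inject≤-injective k≤4 k≤4 _ _

hard-instance : ∀ k → HardInstance k (2 * k ∸ 2)
hard-instance 0 = few-terminals-instance 0 z≤n
hard-instance 1 = HardInstance-mono z≤n (few-terminals-instance 1 (s≤s z≤n))
hard-instance 2 = few-terminals-instance 2 (s≤s (s≤s z≤n))
hard-instance (suc (suc (suc m))) = HardInstance-mono (ℕₚ.≤-reflexive 2k∸2≡N) (caterpillar-instance m)
  where
  open +-*-Solver
  -- the left-hand side below is the normal form of 2 * (3 + m) ∸ 2
  2k∸2≡N : 2 * (3 + m) ∸ 2 ≡ Caterpillar.N m
  2k∸2≡N = solve 1 (λ m → con 1 :+ (m :+ ((con 3 :+ m) :+ con 0)) := (con 3 :+ m) :+ (con 1 :+ m)) refl m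

theorem5 : (i : ℕ) → Σ WGraph (λ G → IsTree G × NonNeg G
             × Σ (Fin (2 ^ i) → Fin (size G)) (λ τ → Injective _≡_ _≡_ τ
             × ((H : WGraph) → DPMinor G τ H → 2 * 2 ^ i ∸ 2 ≤ size H)))
theorem5 i = hard-instance (2 ^ i)
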